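{- Let $N = \{a,b,c,d,e,f,g,x\}$ be a set of eight distinct elements and let $G = \{\{a,b\}, \{a,d,c\}, \{a,e,f\}, \{b,e,c\}, \{b,g,f\}, \{d,x,g\}\}$. In the game in which Black and White alternately claim previously unclaimed elements of $N$, Black moving first, until all of $N$ is claimed, White has a strategy guaranteeing that every set in $G$ contains at least one element claimed by White.
   Context: This is the "BiTriangleX/Line Configuration". It is obtained from the BiTriangleX Configuration, whose groups are $\{a,b\},\{a,d,c\},\{a,e,f\},\{b,e,c\},\{b,g,f\}$, by adding a group through $d$ and $g$ with one new marker $x$. The elements of $N$ are called markers, and the sets in $G$ are the traces on the markers of groups (possible winning lines) of a $k$-in-a-Row game. -}

module Defs where

open import Data.List using (List; []; _∷_)
open import Data.List.Membership.Propositional using (_∈_; _∉_)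
open import Data.List.Relation.Unary.All using (All)
open import Data.List.Relation.Unary.Any using (Any)
open import Data.Product using (Σ; _×_)
open import Relation.Nullary using (¬_)

data Marker : Set where
  a b c d e f g x : Marker

N : List Marker
N = a ∷ b ∷ c ∷ d ∷ e ∷ f ∷ g ∷ x ∷ []

G : List (List Marker)
G = (a ∷ b ∷ [])
  ∷ (a ∷ d ∷ c ∷ [])
  ∷ (a ∷ e ∷ f ∷ [])
  ∷ (b ∷ e ∷ c ∷ [])
  ∷ (b ∷ g ∷ f ∷ [])
  ∷ (d ∷ x ∷ g ∷ [])
  ∷ []

record Position : Set where
  constructor pos
  field
    black : List Marker
    white : List Marker
open Position public

Unclaimed : Position → Marker → Set
Unclaimed p m = m ∉ black p × m ∉ white p

Full : Position → Set
Full p = All (λ m → m ∈ black p ⊎' m ∈ white p) N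
  where
  open import Data.Sum using () renaming (_⊎_ to _⊎'_)

WhiteBlocksAll : Position → Set
WhiteBlocksAll p = All (λ grp → Any (λ m → m ∈ white p) grp) G

-- White can force a win from position p with Black to move:
-- either all of N is claimed and White meets every group, or
-- N is not yet full and for every legal Black move there is a legal
-- White reply (if any marker remains) leading to a White-winning position.
-- (Since |N| = 8 is even, after every Black move White has a move.)
mutual
  data WhiteWinsBlackToMove (p : Position) : Set where
    finished : Full p → WhiteBlocksAll p → WhiteWinsBlackToMove p
    respond  : ¬ Full p →
               (∀ m → m ∈ N → Unclaimed p m →
                  WhiteWinsWhiteToMove (pos (m ∷ black p) (white p)))
             → WhiteWinsBlackToMove p

  data WhiteWinsWhiteToMove (p : Position) : Set where
    reply : (m : Marker) → m ∈ N → Unclaimed p m →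
            WhiteWinsBlackToMove (pos (black p) (m ∷ white p))
          → WhiteWinsWhiteToMove p

start : Position
start = pos [] []

module Submission where

-- White cannot pair the markers from the start: {a,b} forces the pair {a,b}, then {a,d,c} and
-- {a,e,f} force {d,c} and {e,f}, and {b,e,c} contains no pair. But once Black has opened with m,
-- White can take a partner r(m) and split the remaining six markers into three pairs so that
-- every group either contains r(m) or contains one of the pairs; e.g. after a White takes b and
-- pairs {d,c}, {e,f}, {x,g}. Answering every later Black move by its partner, White keeps
-- every group either hit or containing an untouched pair until the board is full.

open import Defs
open import Data.List using (List; []; _∷_; [_]; filter; length)
open import Data.List.Membership.Propositional using (_∈_; _∉_; lose; find)
open import Data.List.Relation.Unary.All as All using (All; []; _∷_; lookup; all?)
open import Data.List.Relation.Unary.Any as Any using (Any; here; there; any?)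
open import Data.Nat using (ℕ; _≤_; _<_; z≤n; s≤s)
open import Data.Nat.Induction using (<-wellFounded)
open import Data.Nat.Properties using (m≤n⇒m≤1+n; eq?)
open import Data.Product using (_×_; _,_; proj₁; proj₂)
open import Data.Sum using (_⊎_; inj₁; inj₂; [_,_]′)
open import Function.Bundles using (mk↣)
open import Induction.WellFounded using (Acc; acc)
open import Relation.Binary using (DecidableEquality)
open import Relation.Binary.PropositionalEquality using (_≡_; _≢_; refl; sym; trans; cong)
open import Relation.Nullary using (Dec; yes; no; ¬_; contradiction)
open import Relation.Nullary.Decidable using (from-yes; map′; ¬?; _×-dec_; _⊎-dec_; _→-dec_)
open import Relation.Unary using (Decidable)

module _ {A : Set} {P Q : A → Set} (P? : Decidable P) (Q? : Decidable Q)
         (Q⇒P : ∀ {y} → Q y → P y) where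

  length-filter-mono : ∀ xs → length (filter Q? xs) ≤ length (filter P? xs)
  length-filter-mono [] = z≤n
  length-filter-mono (y ∷ xs) with Q? y | P? y
  ... | yes _ | yes _ = s≤s (length-filter-mono xs)
  ... | yes q | no ¬p = contradiction (Q⇒P q) ¬p
  ... | no _  | yes _ = m≤n⇒m≤1+n (length-filter-mono xs)
  ... | no _  | no _  = length-filter-mono xs

  length-filter-strict : ∀ {z xs} → z ∈ xs → P z → ¬ Q z →
                         length (filter Q? xs) < length (filter P? xs)
  length-filter-strict {xs = y ∷ xs} (here refl) p ¬q with Q? y | P? y
  ... | yes q | _     = contradiction q ¬q
  ... | no _  | yes _ = s≤s (length-filter-mono xs)
  ... | no _  | no ¬p = contradiction p ¬p
  length-filter-strict {xs = y ∷ xs} (there z∈xs) p ¬q with Q? y | P? y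
  ... | yes _ | yes _ = s≤s (length-filter-strict z∈xs p ¬q)
  ... | yes q | no ¬p = contradiction (Q⇒P q) ¬p
  ... | no _  | yes _ = m≤n⇒m≤1+n (length-filter-strict z∈xs p ¬q)
  ... | no _  | no _  = length-filter-strict z∈xs p ¬q

index : Marker → ℕ
index a = 0
index b = 1
index c = 2
index d = 3
index e = 4
index f = 5
index g = 6
index x = 7

markerAt : ℕ → Marker
markerAt 0 = a
markerAt 1 = b
markerAt 2 = c
markerAt 3 = d
markerAt 4 = e
markerAt 5 = f
markerAt 6 = g
markerAt _ = x

markerAt-index : ∀ m → markerAt (index m) ≡ m
markerAt-index a = refl
markerAt-index b = refl
markerAt-index c = refl
markerAt-index d = refl
markerAt-index e = refl
markerAt-index f = refl
markerAt-index g = refl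
markerAt-index x = refl

_≟_ : DecidableEquality Marker
_≟_ = eq? (mk↣ λ {m} {m′} eq →
  trans (sym (markerAt-index m)) (trans (cong markerAt eq) (markerAt-index m′)))

open import Data.List.Membership.DecPropositional _≟_ using (_∈?_)

∈N : ∀ m → m ∈ N
∈N a = here refl
∈N b = there (here refl)
∈N c = there (there (here refl))
∈N d = there (there (there (here refl)))
∈N e = there (there (there (there (here refl))))
∈N f = there (there (there (there (there (here refl)))))
∈N g = there (there (there (there (there (there (here refl))))))
∈N x = there (there (there (there (there (there (there (here refl)))))))

∉-∷ : ∀ {y m : Marker} {ms} → y ≢ m → y ∉ ms → y ∉ m ∷ ms
∉-∷ y≢m _    (here y≡m) = y≢m y≡m
∉-∷ _   y∉ms (there y∈ms) = y∉ms y∈ms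

unclaimed? : (p : Position) → Decidable (Unclaimed p)
unclaimed? p m = ¬? (m ∈? black p) ×-dec ¬? (m ∈? white p)

claimed : ∀ p {m} → ¬ Unclaimed p m → m ∈ black p ⊎ m ∈ white p
claimed p {m} ¬u with m ∈? black p | m ∈? white p
... | yes m∈b | _       = inj₁ m∈b
... | no _    | yes m∈w = inj₂ m∈w
... | no m∉b  | no m∉w  = contradiction (m∉b , m∉w) ¬u

afterRound : Position → Marker → Marker → Position
afterRound p m m′ = pos (m ∷ black p) (m′ ∷ white p)

module _ {p : Position} {m m′ y : Marker} where

  unclaimed-afterRound : y ≢ m → y ≢ m′ → Unclaimed p y → Unclaimed (afterRound p m m′) y
  unclaimed-afterRound y≢m y≢m′ (y∉b , y∉w) = ∉-∷ y≢m y∉b , ∉-∷ y≢m′ y∉w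

  unclaimed-beforeRound : Unclaimed (afterRound p m m′) y → y ≢ m × y ≢ m′ × Unclaimed p y
  unclaimed-beforeRound (y∉b , y∉w) =
    (λ { refl → y∉b (here refl) }) , (λ { refl → y∉w (here refl) }) ,
    (λ y∈b → y∉b (there y∈b)) , (λ y∈w → y∉w (there y∈w))

free : Position → List Marker
free p = filter (unclaimed? p) N

free-shrinks : ∀ p {m m′} → Unclaimed p m →
               length (free (afterRound p m m′)) < length (free p)
free-shrinks p {m} u =
  length-filter-strict (unclaimed? p) (unclaimed? (afterRound p m _))
    (λ u′ → proj₂ (proj₂ (unclaimed-beforeRound u′))) (∈N m) u
    (λ u′ → proj₁ (unclaimed-beforeRound u′) refl)

record PerfectMatching : Set where
  field
    partner            : Marker → Marker
    partner-involutive : ∀ m → partner (partner m) ≡ m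
    partner-≢          : ∀ m → partner m ≢ m

  partner-injective : ∀ {m m′} → partner m ≡ partner m′ → m ≡ m′
  partner-injective {m} {m′} eq =
    trans (sym (partner-involutive m)) (trans (cong partner eq) (partner-involutive m′))

  partner-≡⇒ : ∀ {m m′} → partner m ≡ m′ → m ≡ partner m′
  partner-≡⇒ {m} eq = trans (sym (partner-involutive m)) (cong partner eq)

  Guarded : Position → List Marker → Set
  Guarded p grp = Any (_∈ white p) grp ⊎ Any (λ y → partner y ∈ grp × Unclaimed p y) grp

  -- The invariant of White's strategy "answer each marker by its partner": no pair is half
  -- claimed, and every group is hit by White or still contains a whole unclaimed pair.
  record SafeFor (p : Position) : Set where
    field
      pairs-unclaimed : All (λ m → Unclaimed p m → Unclaimed p (partner m)) N
      groups-guarded  : All (Guarded p) G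

  safeFor? : ∀ p → Dec (SafeFor p)
  safeFor? p = map′ (λ (u , gs) → record { pairs-unclaimed = u ; groups-guarded = gs })
                    (λ s → SafeFor.pairs-unclaimed s , SafeFor.groups-guarded s)
    (all? (λ m → unclaimed? p m →-dec unclaimed? p (partner m)) N
      ×-dec all? (λ grp → any? (_∈? white p) grp
                  ⊎-dec any? (λ y → (partner y ∈? grp) ×-dec unclaimed? p y) grp) G)

  module _ {p : Position} (safe : SafeFor p) where
    open SafeFor safe

    partner-unclaimed : ∀ {m} → Unclaimed p m →
                        Unclaimed (pos (m ∷ black p) (white p)) (partner m)
    partner-unclaimed {m} u =
      let (pm∉b , pm∉w) = lookup pairs-unclaimed (∈N m) u
      in ∉-∷ (partner-≢ m) pm∉b , pm∉w

    guarded-afterRound : ∀ {m} grp → Guarded p grp → Guarded (afterRound p m (partner m)) grp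
    guarded-afterRound grp (inj₁ hit) = inj₁ (Any.map there hit)
    guarded-afterRound {m} grp (inj₂ pair) with find pair
    ... | y , y∈grp , py∈grp , u with y ≟ m | y ≟ partner m
    ...   | yes refl | _        = inj₁ (lose py∈grp (here refl))
    ...   | no _     | yes refl = inj₁ (lose y∈grp (here refl))
    ...   | no y≢m   | no y≢pm  = inj₂ (lose y∈grp (py∈grp , unclaimed-afterRound y≢m y≢pm u))

    -- If the partner of a surviving marker y were m or partner m, then y itself would be
    -- partner m or m.
    safe-afterRound : ∀ {m} → SafeFor (afterRound p m (partner m))
    safe-afterRound {m} = record
      { pairs-unclaimed = All.tabulate λ {y} _ u′ →
          let (y≢m , y≢pm , u) = unclaimed-beforeRound u′
          in unclaimed-afterRound (λ py≡m → y≢pm (partner-≡⇒ py≡m))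
                                  (λ py≡pm → y≢m (partner-injective py≡pm))
                                  (lookup pairs-unclaimed (∈N y) u)
      ; groups-guarded = All.map (guarded-afterRound _) groups-guarded
      }

    full-wins : (∀ m → ¬ Unclaimed p m) → WhiteWinsBlackToMove p
    full-wins none = finished (All.tabulate λ _ → claimed p (none _))
                              (All.map blocked groups-guarded)
      where
      blocked : ∀ {grp} → Guarded p grp → Any (_∈ white p) grp
      blocked (inj₁ hit)  = hit
      blocked (inj₂ pair) = let (_ , _ , _ , u) = find pair in contradiction u (none _)

  pairing-wins : ∀ p → Acc _<_ (length (free p)) → SafeFor p → WhiteWinsBlackToMove p
  pairing-wins p (acc smaller) safe with any? (unclaimed? p) N
  ... | no none = full-wins safe λ m u → none (lose (∈N m) u)
  ... | yes some =
    let (m₀ , m₀∈N , u₀) = find some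
    in respond (λ full → [ proj₁ u₀ , proj₂ u₀ ]′ (lookup full m₀∈N)) λ m _ u →
         reply (partner m) (∈N _) (partner-unclaimed safe u)
           (pairing-wins _ (smaller (free-shrinks p u)) (safe-afterRound safe))

  wins-when-safe : ∀ {p} → SafeFor p → WhiteWinsBlackToMove p
  wins-when-safe {p} = pairing-wins p (<-wellFounded _)

-- The first pair is Black's opening m with White's answer; every group avoiding that answer
-- contains one of the other three pairs.
matchingAfter : Marker → List (Marker × Marker)
matchingAfter a = (a , b) ∷ (d , c) ∷ (e , f) ∷ (x , g) ∷ []
matchingAfter b = (b , a) ∷ (e , c) ∷ (g , f) ∷ (d , x) ∷ []
matchingAfter c = (c , a) ∷ (b , e) ∷ (g , f) ∷ (d , x) ∷ []
matchingAfter d = (d , a) ∷ (x , g) ∷ (b , f) ∷ (e , c) ∷ []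
matchingAfter e = (e , b) ∷ (a , f) ∷ (d , c) ∷ (x , g) ∷ []
matchingAfter f = (f , b) ∷ (a , e) ∷ (d , c) ∷ (x , g) ∷ []
matchingAfter g = (g , a) ∷ (b , f) ∷ (e , c) ∷ (d , x) ∷ []
matchingAfter x = (x , a) ∷ (d , g) ∷ (e , c) ∷ (b , f) ∷ []

partnerIn : List (Marker × Marker) → Marker → Marker
partnerIn [] y = y
partnerIn ((u , v) ∷ ps) y with y ≟ u | y ≟ v
... | yes _ | _     = v
... | no _  | yes _ = u
... | no _  | no _  = partnerIn ps y

IsPerfectMatching : (Marker → Marker) → Set
IsPerfectMatching π = All (λ m → π (π m) ≡ m × π m ≢ m) N

perfectMatching : ∀ π → IsPerfectMatching π → PerfectMatching
perfectMatching π is = record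
  { partner            = π
  ; partner-involutive = λ m → proj₁ (lookup is (∈N m))
  ; partner-≢          = λ m → proj₂ (lookup is (∈N m))
  }

matchingsPerfect : All (λ m → IsPerfectMatching (partnerIn (matchingAfter m))) N
matchingsPerfect = from-yes (all? (λ m → all? (λ y → let π = partnerIn (matchingAfter m) in
  (π (π y) ≟ y) ×-dec ¬? (π y ≟ y)) N) N)

strategyAfter : Marker → PerfectMatching
strategyAfter m = perfectMatching _ (lookup matchingsPerfect (∈N m))

open PerfectMatching using (partner; partner-≢; SafeFor; safeFor?; wins-when-safe)

openingsSafe : All (λ m → SafeFor (strategyAfter m)
                             (pos [ m ] [ partner (strategyAfter m) m ])) N
openingsSafe =
  from-yes (all? (λ m → safeFor? (strategyAfter m) (pos [ m ] [ partner (strategyAfter m) m ])) N)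

mainTheorem9 : WhiteWinsBlackToMove start
mainTheorem9 = respond (λ { (inj₁ () ∷ _) ; (inj₂ () ∷ _) }) λ m _ _ →
  reply (partner (strategyAfter m) m) (∈N _)
    ((λ { (here eq) → partner-≢ (strategyAfter m) m eq ; (there ()) }) , λ ())
    (wins-when-safe (strategyAfter m) (lookup openingsSafe (∈N m)))
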